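{- Let $\phi$ be an additive functorial interpretation of a polygraphic program $\Pi$. Then for every value $t$ of coarity $1$, $\|t\|\le\phi(t)\le\gamma\|t\|$ in $\mathbb{N}$. Consequently, for every value $t$, $\nu(t)\le\phi(t)\le\gamma\nu(t)$.
   Context: A polygraphic program is a finite 3-polygraph with a single $0$-cell $\ast$ (so $1$-paths are words in $1$-cells) whose $2$-cells split into structure $2$-cells ($\tau_{\xi,\zeta}:\xi\zeta\Rightarrow\zeta\xi$, $\delta_\xi:\xi\Rightarrow\xi\xi$, $\epsilon_\xi:\xi\Rightarrow\ast$), constructor $2$-cells (target a single $1$-cell) and function $2$-cells. $2$-paths are composed by $\star_0$ (parallel) and $\star_1$ (sequential). A value is a $2$-path with source $\ast$ built only from constructor $2$-cells; its coarity is the number of $1$-cells in its target; $\|t\|$ is the number of $2$-cells in $t$. Every value of coarity $n$ is uniquely $t_1\star_0\dots\star_0t_n$ with $t_i$ values of coarity $1$. A functorial interpretation $\phi$ assigns to each $1$-path $u$ with $n$ $1$-cells a nonempty $\phi(u)\subseteq(\mathbb{N}\setminus\{0\})^n$ (with $\phi(\ast)$ a singleton) and to each $2$-path $f:u\Rightarrow v$ a monotone map $\phi(f):\phi(u)\to\phi(v)$, with $\phi(u\star_0v)=\phi(u)\times\phi(v)$, $\phi(f\star_0g)=\phi(f)\times\phi(g)$, $\phi(f\star_1g)=\phi(g)\circ\phi(f)$, identities to identities; for a value $t$, $\phi(t)$ is identified with the tuple it selects. $\phi$ is additive if for every constructor $c$ of arity $n$ there is an integer $c_c\ge1$ with $\phi(c)(x_1,\dots,x_n)=x_1+\dots+x_n+c_c$;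 then $\gamma=\max_c c_c$. $\nu$ is the functorial interpretation on the constructor $2$-cells with $\nu(\xi)=\mathbb{N}\setminus\{0\}$ for every $1$-cell and $\nu(c)(x_1,\dots,x_n)=x_1+\dots+x_n+1$; so $\nu(t_1\star_0\dots\star_0t_n)=(\|t_1\|,\dots,\|t_n\|)$. Tuples are compared componentwise. -}

module Defs where

open import Data.Nat using (ℕ; zero; suc; _+_; _*_; _≤_; _⊔_; z≤n; s≤s)
open import Data.Nat.Properties using (+-mono-≤; ≤-refl; m≤n+m)
open import Data.Fin using (Fin; zero; suc)
open import Data.List using (List; []; _∷_; map; length)
open import Data.Nat.ListAction using (sum)
open import Data.List.Relation.Binary.Pointwise using (Pointwise; []; _∷_)
open import Data.Product using (Σ; _×_; _,_; proj₁; proj₂; ∃)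
open import Relation.Binary.PropositionalEquality using (_≡_)

-- One 0-cell ∗; 1-cells are Fin n₁; a 1-path is a word  List (Fin n₁)
-- (the empty word is ∗).  Constructor 2-cells are Fin n꜀, each with a
-- source word and a target consisting of a single 1-cell.  All other
-- generating 2-cells (structure cells τ, δ, ε and function cells) are
-- Fin nₒ, each with a source and a target word.

record Program : Set where
  field
    n₁      : ℕ
    n꜀      : ℕ
    csrc    : Fin n꜀ → List (Fin n₁)
    ctgt    : Fin n꜀ → Fin n₁
    nₒ      : ℕ
    osrc    : Fin nₒ → List (Fin n₁)
    otgt    : Fin nₒ → List (Fin n₁)

module _ (Π : Program) where
  open Program Π

  Sort : Set
  Sort = Fin n₁

  -- Values: 2-paths with source ∗ made of constructors, represented via
  -- the unique decomposition  t₁ ⋆₀ … ⋆₀ tₙ  (tᵢ of coarity 1), and a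
  -- coarity-1 value being  (args) ⋆₁ c  for a constructor c.
  mutual
    data Value₁ : Sort → Set where
      con : (c : Fin n꜀) → Values (csrc c) → Value₁ (ctgt c)

    data Values : List Sort → Set where
      []  : Values []
      _∷_ : ∀ {ξ u} → Value₁ ξ → Values u → Values (ξ ∷ u)

  mutual
    size₁ : ∀ {ξ} → Value₁ ξ → ℕ
    size₁ (con c ts) = suc (sizes ts)

    sizes : ∀ {u} → Values u → ℕ
    sizes [] = 0
    sizes (t ∷ ts) = size₁ t + sizes ts

  -- Functorial interpretations (determined by their values on the
  -- generating 1-cells and 2-cells, since 1- and 2-paths are free).
  -- φ(ξ) is a nonempty subset of ℕ∖{0}, given as a predicate; φ(u) for a
  -- word u is the product, i.e. lists of naturals pointwise in the sets.

  record ConstructorInterpretation : Set₁ where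
    field
      carrier  : Sort → ℕ → Set
      positive : ∀ ξ x → carrier ξ x → 1 ≤ x
      nonempty : ∀ ξ → ∃ λ x → carrier ξ x

    _∈φ_ : List ℕ → List Sort → Set
    xs ∈φ u = Pointwise (λ x ξ → carrier ξ x) xs u

    field
      φc       : (c : Fin n꜀) (xs : List ℕ) → xs ∈φ csrc c → Σ ℕ (carrier (ctgt c))
      φc-mono  : ∀ c xs ys (p : xs ∈φ csrc c) (q : ys ∈φ csrc c) →
                 Pointwise _≤_ xs ys → proj₁ (φc c xs p) ≤ proj₁ (φc c ys q)

    -- φ(t) for values: the tuple it selects (by functoriality)
    mutual
      ⟦_⟧₁ : ∀ {ξ} → Value₁ ξ → Σ ℕ (carrier ξ)
      ⟦ con c ts ⟧₁ = φc c (proj₁ ⟦ ts ⟧) (proj₂ ⟦ ts ⟧)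

      ⟦_⟧ : ∀ {u} → Values u → Σ (List ℕ) (_∈φ u)
      ⟦ [] ⟧ = [] , []
      ⟦ t ∷ ts ⟧ = (proj₁ ⟦ t ⟧₁ ∷ proj₁ ⟦ ts ⟧) , (proj₂ ⟦ t ⟧₁ ∷ proj₂ ⟦ ts ⟧)

    φ₁ : ∀ {ξ} → Value₁ ξ → ℕ
    φ₁ t = proj₁ ⟦ t ⟧₁

    φ : ∀ {u} → Values u → List ℕ
    φ ts = proj₁ ⟦ ts ⟧

  record Interpretation : Set₁ where
    field
      onConstructors : ConstructorInterpretation
    open ConstructorInterpretation onConstructors public
    field
      φo       : (f : Fin nₒ) (xs : List ℕ) → xs ∈φ osrc f → Σ (List ℕ) (_∈φ otgt f)
      φo-mono  : ∀ f xs ys (p : xs ∈φ osrc f) (q : ys ∈φ osrc f) →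
                 Pointwise _≤_ xs ys →
                 Pointwise _≤_ (proj₁ (φo f xs p)) (proj₁ (φo f ys q))

  record Additive (I : Interpretation) : Set where
    open Interpretation I
    field
      cst     : Fin n꜀ → ℕ
      cst≥1   : ∀ c → 1 ≤ cst c
      additive : ∀ c xs (p : xs ∈φ csrc c) → proj₁ (φc c xs p) ≡ sum xs + cst c

  maxFin : (n : ℕ) → (Fin n → ℕ) → ℕ
  maxFin zero    f = 0
  maxFin (suc n) f = f zero ⊔ maxFin n (λ i → f (suc i))

  γ : ∀ {I} → Additive I → ℕ
  γ A = maxFin n꜀ (Additive.cst A)

  sum-mono : ∀ {xs ys} → Pointwise _≤_ xs ys → sum xs ≤ sum ys
  sum-mono []       = z≤n
  sum-mono (p ∷ ps) = +-mono-≤ p (sum-mono ps)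

  ν : ConstructorInterpretation
  ν = record
    { carrier  = λ _ x → 1 ≤ x
    ; positive = λ _ _ p → p
    ; nonempty = λ _ → 1 , s≤s z≤n
    ; φc       = λ c xs _ → sum xs + 1 , m≤n+m 1 (sum xs)
    ; φc-mono  = λ c xs ys _ _ le → +-mono-≤ (sum-mono le) ≤-refl
    }

{-# OPTIONS --safe #-}
-- Under an additive interpretation, each constructor adds between 1 and γ to
-- the sum of its arguments, while it contributes exactly 1 to the size.
-- Induction on values therefore gives ‖t‖ ≤ φ(t) ≤ γ‖t‖, and ν is the
-- interpretation for which both bounds hold with γ = 1, i.e. ν(t) = ‖t‖.
module Submission where

open import Defs
open import Data.Nat using (ℕ; _*_; _≤_; _<_; _+_; suc; z≤n; s≤s)
open import Data.Nat.Properties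
  using ( ≤-refl; ≤-reflexive; ≤-trans; ≤-antisym; m≤m⊔n; m≤n⊔m; m<m+n
        ; +-comm; +-mono-≤; +-monoˡ-≤; +-monoʳ-≤; *-suc; *-zeroʳ; *-identityˡ; *-distribˡ-+
        ; module ≤-Reasoning )
open import Data.Fin using (Fin; zero; suc)
open import Data.List using (map)
open import Data.List.Properties using (map-id)
open import Data.Nat.ListAction using (sum)
open import Data.List.Relation.Binary.Pointwise using (Pointwise; []; _∷_; map⁺)
open import Data.Product using (_×_; _,_; proj₁; proj₂)
open import Function using (id)
open import Relation.Binary.PropositionalEquality using (_≡_; sym; cong; subst)

module _ (Π : Program) where
  open Program Π

  maxFin-upper : ∀ n (f : Fin n → ℕ) i → f i ≤ maxFin Π n f
  maxFin-upper (suc n) f zero    = m≤m⊔n _ _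
  maxFin-upper (suc n) f (suc i) = ≤-trans (maxFin-upper n (λ j → f (suc j)) i) (m≤n⊔m _ _)

  module _ (ψ : ConstructorInterpretation Π) where
    open ConstructorInterpretation ψ

    module _ (inflationary : ∀ c xs p → sum xs < proj₁ (φc c xs p)) where
      mutual
        size₁≤φ₁ : ∀ {ξ} (t : Value₁ Π ξ) → size₁ Π t ≤ φ₁ t
        size₁≤φ₁ (con c ts) = ≤-trans (s≤s (sizes≤sum-φ ts)) (inflationary c (φ ts) (proj₂ ⟦ ts ⟧))

        sizes≤sum-φ : ∀ {u} (ts : Values Π u) → sizes Π ts ≤ sum (φ ts)
        sizes≤sum-φ []       = z≤n
        sizes≤sum-φ (t ∷ ts) = +-mono-≤ (size₁≤φ₁ t) (sizes≤sum-φ ts)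

    module _ (k : ℕ) (increment≤ : ∀ c xs p → proj₁ (φc c xs p) ≤ sum xs + k) where
      mutual
        φ₁≤*size₁ : ∀ {ξ} (t : Value₁ Π ξ) → φ₁ t ≤ k * size₁ Π t
        φ₁≤*size₁ (con c ts) = begin
          φ₁ (con c ts)          ≤⟨ increment≤ c (φ ts) (proj₂ ⟦ ts ⟧) ⟩
          sum (φ ts) + k         ≤⟨ +-monoˡ-≤ k (sum-φ≤*sizes ts) ⟩
          k * sizes Π ts + k     ≡⟨ +-comm (k * sizes Π ts) k ⟩
          k + k * sizes Π ts     ≡⟨ *-suc k (sizes Π ts) ⟨
          k * suc (sizes Π ts)   ∎
          where open ≤-Reasoning

        sum-φ≤*sizes : ∀ {u} (ts : Values Π u) → sum (φ ts) ≤ k * sizes Π ts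
        sum-φ≤*sizes []       = ≤-reflexive (sym (*-zeroʳ k))
        sum-φ≤*sizes (t ∷ ts) = begin
          φ₁ t + sum (φ ts)                 ≤⟨ +-mono-≤ (φ₁≤*size₁ t) (sum-φ≤*sizes ts) ⟩
          k * size₁ Π t + k * sizes Π ts    ≡⟨ *-distribˡ-+ k (size₁ Π t) (sizes Π ts) ⟨
          k * (size₁ Π t + sizes Π ts)      ∎
          where open ≤-Reasoning

  module _ (R : ℕ → ℕ → Set) (ψ ψ′ : ConstructorInterpretation Π) where
    private
      module ψ  = ConstructorInterpretation ψ
      module ψ′ = ConstructorInterpretation ψ′

    pointwise-φ : (∀ {ξ} (t : Value₁ Π ξ) → R (ψ.φ₁ t) (ψ′.φ₁ t)) →
                  ∀ {u} (ts : Values Π u) → Pointwise R (ψ.φ ts) (ψ′.φ ts)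
    pointwise-φ R-φ₁ []       = []
    pointwise-φ R-φ₁ (t ∷ ts) = R-φ₁ t ∷ pointwise-φ R-φ₁ ts

  ν-φ₁≡size₁ : ∀ {ξ} (t : Value₁ Π ξ) → ConstructorInterpretation.φ₁ (ν Π) t ≡ size₁ Π t
  ν-φ₁≡size₁ t = ≤-antisym
    (≤-trans (φ₁≤*size₁ (ν Π) 1 (λ _ _ _ → ≤-refl) t) (≤-reflexive (*-identityˡ _)))
    (size₁≤φ₁ (ν Π) (λ _ xs _ → ≤-reflexive (+-comm 1 (sum xs))) t)

  module _ {I : Interpretation Π} (A : Additive Π I) where
    open Interpretation I
    open Additive A

    additive-inflationary : ∀ c xs p → sum xs < proj₁ (φc c xs p)
    additive-inflationary c xs p = begin-strict
      sum xs             <⟨ m<m+n (sum xs) (cst≥1 c) ⟩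
      sum xs + cst c     ≡⟨ additive c xs p ⟨
      proj₁ (φc c xs p)  ∎
      where open ≤-Reasoning

    additive-increment≤γ : ∀ c xs p → proj₁ (φc c xs p) ≤ sum xs + γ Π A
    additive-increment≤γ c xs p = begin
      proj₁ (φc c xs p)  ≡⟨ additive c xs p ⟩
      sum xs + cst c     ≤⟨ +-monoʳ-≤ (sum xs) (maxFin-upper n꜀ cst c) ⟩
      sum xs + γ Π A     ∎
      where open ≤-Reasoning

proposition3p4 : (Π : Program) (I : Interpretation Π) (A : Additive Π I) →
    (∀ {ξ} (t : Value₁ Π ξ) →
        size₁ Π t ≤ Interpretation.φ₁ I t
      × Interpretation.φ₁ I t ≤ γ Π A * size₁ Π t)
    × (∀ {u} (t : Values Π u) →
        Pointwise _≤_ (ConstructorInterpretation.φ (ν Π) t) (Interpretation.φ I t)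
      × Pointwise _≤_ (Interpretation.φ I t) (map (γ Π A *_) (ConstructorInterpretation.φ (ν Π) t)))
proposition3p4 Π I A = (λ t → lower t , upper t) , λ ts → lowerᵥ ts , upperᵥ ts
  where
  ψ : ConstructorInterpretation Π
  ψ = Interpretation.onConstructors I

  g : ℕ
  g = γ Π A

  open ConstructorInterpretation ψ using (φ₁; φ)
  open ConstructorInterpretation (ν Π) using () renaming (φ₁ to ν₁; φ to νᵥ)

  lower : ∀ {ξ} (t : Value₁ Π ξ) → size₁ Π t ≤ φ₁ t
  lower = size₁≤φ₁ Π ψ (additive-inflationary Π A)

  upper : ∀ {ξ} (t : Value₁ Π ξ) → φ₁ t ≤ g * size₁ Π t
  upper = φ₁≤*size₁ Π ψ g (additive-increment≤γ Π A)

  lowerᵥ : ∀ {u} (ts : Values Π u) → Pointwise _≤_ (νᵥ ts) (φ ts)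
  lowerᵥ = pointwise-φ Π _≤_ (ν Π) ψ λ t → ≤-trans (≤-reflexive (ν-φ₁≡size₁ Π t)) (lower t)

  upperᵥ : ∀ {u} (ts : Values Π u) → Pointwise _≤_ (φ ts) (map (g *_) (νᵥ ts))
  upperᵥ ts = subst (λ xs → Pointwise _≤_ xs (map (g *_) (νᵥ ts))) (map-id (φ ts))
    (map⁺ id (g *_) (pointwise-φ Π (λ x n → x ≤ g * n) ψ (ν Π) upper′ ts))
    where
    upper′ : ∀ {ξ} (t : Value₁ Π ξ) → φ₁ t ≤ g * ν₁ t
    upper′ t = ≤-trans (upper t) (≤-reflexive (cong (g *_) (sym (ν-φ₁≡size₁ Π t))))
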